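{- Let $T$ be a rooted tree with root $v^*$, let $v_1,\ldots,v_t$ be the children of $v^*$, and let $T_i$ be the subtree consisting of $v_i$ and its descendants, rooted at $v_i$. For each $i$, let $F(T_i)$ be the edge set of a maximum linear forest of $T_i$, and let $F'(T_i)$ be the edge set of a linear forest of $T_i$ with the maximum number of edges among linear forests of $T_i$ in which $v_i$ has degree at most one. Define \[ P(T)=\bigcup_{i=1}^t F(T_i),\qquad Q_i(T)=\Big(\bigcup_{l\neq i}F(T_l)\Big)\cup F'(T_i)\cup\{v^*v_i\}, \] \[ R_{ij}(T)=\Big(\bigcup_{l\neq i,j}F(T_l)\Big)\cup F'(T_i)\cup F'(T_j)\cup\{v^*v_i,v^*v_j\}\quad(i\neq j). \] Let $S(T)$ be one of largest cardinality among $P(T)$, all $Q_i(T)$ and all $R_{ij}(T)$, and let $S'(T)$ be one of largest cardinality among $P(T)$ and all $Q_i(T)$. Then $S(T)$ is (the edge set of) a maximum linear forest in $T$, and $S'(T)$ is a linear forest in $T$ with the maximum number of edges among linear forests of $T$ in which $v^*$ has degree at most one.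
   Context: A linear forest in a graph is a subgraph that is a vertex-disjoint union of simple paths (identified with its edge set); a maximum linear forest is one with the maximum number of edges. -}

module Defs where

open import Data.Nat using (ℕ; zero; suc; _+_; _≤_)
open import Data.Fin using (Fin; zero; suc; _≟_)
open import Data.Bool using (Bool; true; false; if_then_else_; _∨_)
open import Data.Product using (_×_)
open import Relation.Nullary.Decidable using (⌊_⌋)

data Tree : Set where
  node : (k : ℕ) → (Fin k → Tree) → Tree

data Vertex : Tree → Set where
  root : ∀ {t} → Vertex t
  sub  : ∀ {k ch} (i : Fin k) → Vertex (ch i) → Vertex (node k ch)

-- Every edge of a rooted tree joins a vertex to
-- one of its children, so an edge set records, at each node, which of the
-- edges to its children are chosen, and recursively the edge sets of the
-- child subtrees.
data ESet : Tree → Set where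
  eset : ∀ {k ch} → (Fin k → Bool) → ((i : Fin k) → ESet (ch i)) → ESet (node k ch)

bit : Bool → ℕ
bit true  = 1
bit false = 0

sumFin : (k : ℕ) → (Fin k → ℕ) → ℕ
sumFin zero    f = 0
sumFin (suc k) f = f zero + sumFin k (λ i → f (suc i))

size : ∀ {t} → ESet t → ℕ
size (eset {k} b fs) = sumFin k (λ i → bit (b i) + size (fs i))

-- degree of a vertex in the subgraph (V(T), S); the Bool records whether the
-- edge from the current node to its parent is in the set (false at the root of T).
deg′ : ∀ {t} → Bool → ESet t → Vertex t → ℕ
deg′ p (eset {k} b fs) root    = bit p + sumFin k (λ i → bit (b i))
deg′ p (eset b fs)     (sub i v) = deg′ (b i) (fs i) v

deg : ∀ {t} → ESet t → Vertex t → ℕ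
deg S v = deg′ false S v

-- A linear forest of a tree T: a subgraph of T (hence acyclic) in which every
-- vertex has degree at most 2, i.e. a vertex-disjoint union of simple paths.
LinearForest : ∀ {t} → ESet t → Set
LinearForest {t} S = (v : Vertex t) → deg S v ≤ 2

IsMaxLF : ∀ {t} → ESet t → Set
IsMaxLF {t} S = LinearForest S × ((L : ESet t) → LinearForest L → size L ≤ size S)

IsMaxLF₁ : ∀ {t} → ESet t → Set
IsMaxLF₁ {t} S =
  (LinearForest S × deg S root ≤ 1) ×
  ((L : ESet t) → LinearForest L → deg L root ≤ 1 → size L ≤ size S)

module _ {k : ℕ} {ch : Fin k → Tree}
         (F F′ : (i : Fin k) → ESet (ch i)) where

  P : ESet (node k ch)
  P = eset (λ _ → false) F

  Q : Fin k → ESet (node k ch)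
  Q i = eset (λ l → ⌊ l ≟ i ⌋) (λ l → if ⌊ l ≟ i ⌋ then F′ l else F l)

  R : Fin k → Fin k → ESet (node k ch)
  R i j = eset (λ l → ⌊ l ≟ i ⌋ ∨ ⌊ l ≟ j ⌋)
               (λ l → if ⌊ l ≟ i ⌋ ∨ ⌊ l ≟ j ⌋ then F′ l else F l)

{-# OPTIONS --safe #-}
module Submission where

-- A linear forest L of T consists of a set C of root edges v*v_i and, for each i, a
-- subgraph L_i of T_i.  Degree at most 2 at v* says |C| ≤ 2, and L_i must be a linear
-- forest of T_i in which v_i has degree at most 1 when v*v_i ∈ C.  Hence
-- |L_i| ≤ |F'(T_i)| or |L_i| ≤ |F(T_i)| according as v*v_i ∈ C or not, and putting
-- these optima in place of the L_i again gives a linear forest, namely P, Q_i or R_ij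
-- according as |C| = 0, 1 or 2.  Requiring degree at most 1 at v* excludes |C| = 2.

open import Defs
open import Algebra.Properties.CommutativeSemigroup using (interchange)
open import Data.Bool using (Bool; true; false; if_then_else_; _∨_)
open import Data.Fin using (Fin; zero; suc; _≟_)
open import Data.Fin.Properties using (suc-injective)
open import Data.Nat using (ℕ; zero; suc; _+_; _≤_; z≤n; s≤s; s≤s⁻¹)
open import Data.Nat.Properties
  using (+-commutativeSemigroup; +-mono-≤; +-monoʳ-≤; ≤-refl; ≤-trans; ≤-reflexive; m≤n+m; module ≤-Reasoning)
open import Data.Product using (Σ; _×_; _,_; proj₁; proj₂)
open import Data.Sum using (_⊎_; inj₁; inj₂)
open import Function using (_∘_)
open import Relation.Nullary.Decidable using (⌊_⌋; yes; no)
open import Relation.Binary.PropositionalEquality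
  using (_≡_; _≢_; _≗_; refl; sym; trans; cong; cong₂)

sumFin-mono : ∀ k {f g : Fin k → ℕ} → (∀ i → f i ≤ g i) → sumFin k f ≤ sumFin k g
sumFin-mono zero    f≤g = z≤n
sumFin-mono (suc k) f≤g = +-mono-≤ (f≤g zero) (sumFin-mono k (f≤g ∘ suc))

sumFin-cong : ∀ k {f g : Fin k → ℕ} → f ≗ g → sumFin k f ≡ sumFin k g
sumFin-cong zero    f≗g = refl
sumFin-cong (suc k) f≗g = cong₂ _+_ (f≗g zero) (sumFin-cong k (f≗g ∘ suc))

sumFin-+ : ∀ k (f g : Fin k → ℕ) → sumFin k (λ i → f i + g i) ≡ sumFin k f + sumFin k g
sumFin-+ zero    f g = refl
sumFin-+ (suc k) f g =
  trans (cong (f zero + g zero +_) (sumFin-+ k (f ∘ suc) (g ∘ suc)))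
        (interchange +-commutativeSemigroup (f zero) (g zero) _ _)

head-tail⇒≗ : ∀ {k} {A : Set} {f g : Fin (suc k) → A} → f zero ≡ g zero → f ∘ suc ≗ g ∘ suc → f ≗ g
head-tail⇒≗ f₀≡g₀ _       zero    = f₀≡g₀
head-tail⇒≗ _     fₛ≗gₛ (suc i) = fₛ≗gₛ i

∅ : ∀ {k} → Fin k → Bool
∅ _ = false

⁅_⁆ : ∀ {k} → Fin k → Fin k → Bool
⁅ i ⁆ l = ⌊ l ≟ i ⌋

⁅_⁆∨⁅_⁆ : ∀ {k} → Fin k → Fin k → Fin k → Bool
⁅ i ⁆∨⁅ j ⁆ l = ⁅ i ⁆ l ∨ ⁅ j ⁆ l

⁅suc⁆∘suc : ∀ {k} (i : Fin k) → ⁅ suc i ⁆ ∘ suc ≗ ⁅ i ⁆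
⁅suc⁆∘suc i l with l ≟ i
... | yes _ = refl
... | no  _ = refl

count : ∀ {k} → (Fin k → Bool) → ℕ
count {k} c = sumFin k (bit ∘ c)

count-∅ : ∀ k → count (∅ {k}) ≡ 0
count-∅ zero    = refl
count-∅ (suc k) = count-∅ k

count-⁅⁆ : ∀ {k} (i : Fin k) → count ⁅ i ⁆ ≡ 1
count-⁅⁆ {suc k} zero    = cong suc (count-∅ k)
count-⁅⁆ {suc k} (suc i) = trans (sumFin-cong k (cong bit ∘ ⁅suc⁆∘suc i)) (count-⁅⁆ i)

bit-∨ : ∀ a b → bit (a ∨ b) ≤ bit a + bit b
bit-∨ true  _ = s≤s z≤n
bit-∨ false _ = ≤-refl

count-⁅⁆∨⁅⁆ : ∀ {k} (i j : Fin k) → count ⁅ i ⁆∨⁅ j ⁆ ≤ 2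
count-⁅⁆∨⁅⁆ {k} i j = begin
  count ⁅ i ⁆∨⁅ j ⁆                                ≤⟨ sumFin-mono k (λ l → bit-∨ (⁅ i ⁆ l) (⁅ j ⁆ l)) ⟩
  sumFin k (λ l → bit (⁅ i ⁆ l) + bit (⁅ j ⁆ l))  ≡⟨ sumFin-+ k _ _ ⟩
  count ⁅ i ⁆ + count ⁅ j ⁆                        ≡⟨ cong₂ _+_ (count-⁅⁆ i) (count-⁅⁆ j) ⟩
  2                                                ∎
  where open ≤-Reasoning

≗⁅suc⁆ : ∀ {k} {c : Fin (suc k) → Bool} {i} → c zero ≡ false → c ∘ suc ≗ ⁅ i ⁆ → c ≗ ⁅ suc i ⁆
≗⁅suc⁆ {i = i} c₀ cₛ≗i = head-tail⇒≗ c₀ λ l → trans (cₛ≗i l) (sym (⁅suc⁆∘suc i l))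

data AtMostOne {k} (c : Fin k → Bool) : Set where
  empty  : c ≗ ∅ → AtMostOne c
  single : (i : Fin k) → c ≗ ⁅ i ⁆ → AtMostOne c

data AtMostTwo {k} (c : Fin k → Bool) : Set where
  atMostOne : AtMostOne c → AtMostTwo c
  pair      : (i j : Fin k) → i ≢ j → c ≗ ⁅ i ⁆∨⁅ j ⁆ → AtMostTwo c

count≤0⇒≗∅ : ∀ {k} (c : Fin k → Bool) → count c ≤ 0 → c ≗ ∅
count≤0⇒≗∅ {suc k} c h with c zero in c₀
count≤0⇒≗∅ {suc k} c () | true
... | false = head-tail⇒≗ c₀ (count≤0⇒≗∅ (c ∘ suc) h)

count≤1⇒atMostOne : ∀ {k} (c : Fin k → Bool) → count c ≤ 1 → AtMostOne c
count≤1⇒atMostOne {zero}  c _ = empty λ ()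
count≤1⇒atMostOne {suc k} c h with c zero in c₀
... | true  = single zero (head-tail⇒≗ c₀ (count≤0⇒≗∅ (c ∘ suc) (s≤s⁻¹ h)))
... | false with count≤1⇒atMostOne (c ∘ suc) h
...   | empty  cₛ≗∅  = empty (head-tail⇒≗ c₀ cₛ≗∅)
...   | single i cₛ≗i = single (suc i) (≗⁅suc⁆ c₀ cₛ≗i)

count≤2⇒atMostTwo : ∀ {k} (c : Fin k → Bool) → count c ≤ 2 → AtMostTwo c
count≤2⇒atMostTwo {zero}  c _ = atMostOne (empty λ ())
count≤2⇒atMostTwo {suc k} c h with c zero in c₀
... | true with count≤1⇒atMostOne (c ∘ suc) (s≤s⁻¹ h)
...   | empty  cₛ≗∅  = atMostOne (single zero (head-tail⇒≗ c₀ cₛ≗∅))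
...   | single i cₛ≗i = pair zero (suc i) (λ ())
                          (head-tail⇒≗ c₀ λ l → trans (cₛ≗i l) (sym (⁅suc⁆∘suc i l)))
count≤2⇒atMostTwo {suc k} c h | false with count≤2⇒atMostTwo (c ∘ suc) h
... | atMostOne (empty  cₛ≗∅)  = atMostOne (empty (head-tail⇒≗ c₀ cₛ≗∅))
... | atMostOne (single i cₛ≗i) = atMostOne (single (suc i) (≗⁅suc⁆ c₀ cₛ≗i))
... | pair i j i≢j cₛ≗ij = pair (suc i) (suc j) (i≢j ∘ suc-injective)
  (head-tail⇒≗ c₀ λ l → trans (cₛ≗ij l) (sym (cong₂ _∨_ (⁅suc⁆∘suc i l) (⁅suc⁆∘suc j l))))

-- Linear forests of a child subtree T_i, together with the edge v*v_i when p = true.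

LinearForest⁺ : ∀ {t} → Bool → ESet t → Set
LinearForest⁺ {t} p S = (v : Vertex t) → deg′ p S v ≤ 2

deg≤deg′ : ∀ {t} p (S : ESet t) v → deg S v ≤ deg′ p S v
deg≤deg′ p (eset _ _) root      = m≤n+m _ (bit p)
deg≤deg′ p (eset _ _) (sub i v) = ≤-refl

linearForest⁺-true⇒ : ∀ {t} (S : ESet t) → LinearForest⁺ true S → LinearForest S × deg S root ≤ 1
linearForest⁺-true⇒ S@(eset _ _) h = (λ v → ≤-trans (deg≤deg′ true S v) (h v)) , s≤s⁻¹ (h root)

linearForest⁺-true⇐ : ∀ {t} (S : ESet t) → LinearForest S → deg S root ≤ 1 → LinearForest⁺ true S
linearForest⁺-true⇐ (eset _ _) lf r root      = s≤s r
linearForest⁺-true⇐ (eset _ _) lf r (sub i v) = lf (sub i v)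

module Combine {k : ℕ} {ch : Fin k → Tree} (F F′ : (i : Fin k) → ESet (ch i))
               (maxF : (i : Fin k) → IsMaxLF (F i)) (maxF′ : (i : Fin k) → IsMaxLF₁ (F′ i)) where

  optimum : Bool → (l : Fin k) → ESet (ch l)
  optimum p l = if p then F′ l else F l

  -- P, Q i and R i j are definitionally combine ∅, combine ⁅ i ⁆ and combine ⁅ i ⁆∨⁅ j ⁆.
  combine : (Fin k → Bool) → ESet (node k ch)
  combine c = eset c (λ l → optimum (c l) l)

  optimum-linearForest⁺ : ∀ p l → LinearForest⁺ p (optimum p l)
  optimum-linearForest⁺ true  l = let ((lf , r) , _) = maxF′ l in linearForest⁺-true⇐ (F′ l) lf r
  optimum-linearForest⁺ false l = proj₁ (maxF l)

  size≤size-optimum : ∀ p l (S : ESet (ch l)) → LinearForest⁺ p S → size S ≤ size (optimum p l)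
  size≤size-optimum true  l S h = let (lf , r) = linearForest⁺-true⇒ S h in proj₂ (maxF′ l) S lf r
  size≤size-optimum false l S h = proj₂ (maxF l) S h

  combine-linearForest : ∀ c → count c ≤ 2 → LinearForest (combine c)
  combine-linearForest c h root      = h
  combine-linearForest c h (sub l v) = optimum-linearForest⁺ (c l) l v

  size≤size-combine : ∀ b fs → LinearForest (eset b fs) → size (eset b fs) ≤ size (combine b)
  size≤size-combine b fs lf =
    sumFin-mono k λ l → +-monoʳ-≤ (bit (b l)) (size≤size-optimum (b l) l (fs l) (lf ∘ sub l))

  size-combine-cong : ∀ {c d} → c ≗ d → size (combine c) ≡ size (combine d)
  size-combine-cong c≗d = sumFin-cong k λ l → cong (λ x → bit x + size (optimum x l)) (c≗d l)

  module _ {n : ℕ} (P≤n : size (P F F′) ≤ n) (Q≤n : ∀ i → size (Q F F′ i) ≤ n) where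

    atMostOne⇒size-combine≤ : ∀ {c} → AtMostOne c → size (combine c) ≤ n
    atMostOne⇒size-combine≤ (empty  c≗∅) = ≤-trans (≤-reflexive (size-combine-cong c≗∅)) P≤n
    atMostOne⇒size-combine≤ (single i c≗i) = ≤-trans (≤-reflexive (size-combine-cong c≗i)) (Q≤n i)

    linearForest₁-size≤ : (L : ESet (node k ch)) → LinearForest L → deg L root ≤ 1 → size L ≤ n
    linearForest₁-size≤ (eset b fs) lf r =
      ≤-trans (size≤size-combine b fs lf) (atMostOne⇒size-combine≤ (count≤1⇒atMostOne b r))

    module _ (R≤n : ∀ i j → i ≢ j → size (R F F′ i j) ≤ n) where

      atMostTwo⇒size-combine≤ : ∀ {c} → AtMostTwo c → size (combine c) ≤ n
      atMostTwo⇒size-combine≤ (atMostOne c≤1) = atMostOne⇒size-combine≤ c≤1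
      atMostTwo⇒size-combine≤ (pair i j i≢j c≗ij) =
        ≤-trans (≤-reflexive (size-combine-cong c≗ij)) (R≤n i j i≢j)

      linearForest-size≤ : (L : ESet (node k ch)) → LinearForest L → size L ≤ n
      linearForest-size≤ (eset b fs) lf =
        ≤-trans (size≤size-combine b fs lf) (atMostTwo⇒size-combine≤ (count≤2⇒atMostTwo b (lf root)))

  IsCandidate₁ : ESet (node k ch) → Set
  IsCandidate₁ S = S ≡ P F F′ ⊎ Σ (Fin k) (λ i → S ≡ Q F F′ i)

  IsCandidate : ESet (node k ch) → Set
  IsCandidate S = S ≡ P F F′ ⊎ Σ (Fin k) (λ i → S ≡ Q F F′ i)
                    ⊎ Σ (Fin k) (λ i → Σ (Fin k) (λ j → i ≢ j × S ≡ R F F′ i j))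

  candidate-linearForest : ∀ {S} → IsCandidate S → LinearForest S
  candidate-linearForest (inj₁ refl) =
    combine-linearForest ∅ (≤-trans (≤-reflexive (count-∅ k)) z≤n)
  candidate-linearForest (inj₂ (inj₁ (i , refl))) =
    combine-linearForest ⁅ i ⁆ (≤-trans (≤-reflexive (count-⁅⁆ i)) (s≤s z≤n))
  candidate-linearForest (inj₂ (inj₂ (i , j , _ , refl))) =
    combine-linearForest ⁅ i ⁆∨⁅ j ⁆ (count-⁅⁆∨⁅⁆ i j)

  candidate₁-linearForest₁ : ∀ {S} → IsCandidate₁ S → LinearForest S × deg S root ≤ 1
  candidate₁-linearForest₁ (inj₁ refl) =
    candidate-linearForest (inj₁ refl) , ≤-trans (≤-reflexive (count-∅ k)) z≤n
  candidate₁-linearForest₁ (inj₂ (i , refl)) =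
    candidate-linearForest (inj₂ (inj₁ (i , refl))) , ≤-reflexive (count-⁅⁆ i)

mainTheorem16 : (k : ℕ) (ch : Fin k → Tree)
    (F F′ : (i : Fin k) → ESet (ch i)) →
    ((i : Fin k) → IsMaxLF (F i)) →
    ((i : Fin k) → IsMaxLF₁ (F′ i)) →
    (S S′ : ESet (node k ch)) →
    ((S ≡ P F F′) ⊎ (Σ (Fin k) (λ i → S ≡ Q F F′ i))
      ⊎ (Σ (Fin k) (λ i → Σ (Fin k) (λ j → i ≢ j × S ≡ R F F′ i j)))) →
    size (P F F′) ≤ size S →
    ((i : Fin k) → size (Q F F′ i) ≤ size S) →
    ((i j : Fin k) → i ≢ j → size (R F F′ i j) ≤ size S) →
    ((S′ ≡ P F F′) ⊎ (Σ (Fin k) (λ i → S′ ≡ Q F F′ i))) →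
    size (P F F′) ≤ size S′ →
    ((i : Fin k) → size (Q F F′ i) ≤ size S′) →
    IsMaxLF S × IsMaxLF₁ S′
mainTheorem16 k ch F F′ maxF maxF′ S S′ S-cand P≤S Q≤S R≤S S′-cand P≤S′ Q≤S′ =
  (candidate-linearForest S-cand , linearForest-size≤ P≤S Q≤S R≤S) ,
  (candidate₁-linearForest₁ S′-cand , linearForest₁-size≤ P≤S′ Q≤S′)
  where open Combine F F′ maxF maxF′
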